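{- For each tree $T$ on a finite set $I$, the interval $[\hat 0, T]$ of the poset $\operatorname{For}(I)$ is a lattice.
   Context: A tree on a finite set $I$ is a rooted binary tree (not considered as planar) whose leaves are bijectively labeled by $I$: every vertex is either an inner vertex of valence 3, or a vertex of valence 1 (a leaf or the root); edges are oriented towards the root. A forest on $I$ is a set of trees on pairwise disjoint label sets whose union is $I$. For forests $F,G$ on $I$, $F\le G$ means there is a continuous map from $F$ to $G$ (forests viewed as 1-dimensional complexes) such that: (D1) it is increasing with respect to the orientation towards the root; (D2) it maps inner vertices to inner vertices injectively; (D3) it restricts to the identity of $I$ on leaves; (D4) its restriction to each tree of $F$ is injective. $\operatorname{For}(I)$ is the set of forests on $I$ with this partial order; its minimum $\hat 0$ is the forest with no inner vertices. -}

module Defs where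

open import Data.Nat using (ℕ; _≥_)
open import Data.Fin using (Fin)
open import Data.Fin.Subset using (Subset; ⁅_⁆; _⊆_; _∩_; _∪_; Empty; ∣_∣)
  renaming (_∈_ to _∈ˢ_)
open import Data.List using (List; [])
open import Data.List.Membership.Propositional using () renaming (_∈_ to _∈ᶜ_)
open import Data.Product using (Σ; ∃; ∃-syntax; _×_)
open import Data.Sum using (_⊎_)
open import Relation.Binary.PropositionalEquality using (_≡_)

-- Encoding: the finite label set I is Fin n.  A forest on I
-- is encoded (canonically, i.e. up to isomorphism of forests) by the list of
-- the leaf-sets ("clades") of its inner vertices; the leaf-set of an inner
-- vertex is the set of leaves lying below it.

-- a "piece" of a forest: the leaf-set of an inner vertex or of a leaf
Piece : ∀ {n} → List (Subset n) → Subset n → Set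
Piece C p = p ∈ᶜ C ⊎ ∃[ i ] p ≡ ⁅ i ⁆

Disjoint : ∀ {n} → Subset n → Subset n → Set
Disjoint a b = Empty (a ∩ b)

-- the vertex with leaf-set c has the two children with leaf-sets a and b
Split : ∀ {n} → List (Subset n) → Subset n → Subset n → Subset n → Set
Split C c a b = Piece C a × Piece C b × Disjoint a b × (a ∪ b) ≡ c

-- a family of clades comes from a forest of rooted binary trees
record IsForest {n : ℕ} (C : List (Subset n)) : Set where
  field
    size≥2  : ∀ c → c ∈ᶜ C → ∣ c ∣ ≥ 2
    laminar : ∀ c d → c ∈ᶜ C → d ∈ᶜ C → c ⊆ d ⊎ d ⊆ c ⊎ Disjoint c d
    binary  : ∀ c → c ∈ᶜ C → ∃[ a ] ∃[ b ] Split C c a b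

record Forest (n : ℕ) : Set where
  constructor forest
  field
    clades : List (Subset n)
    wf     : IsForest clades
open Forest public

𝟘 : ∀ {n} → Forest n
𝟘 = forest [] (record { size≥2 = λ _ () ; laminar = λ _ _ () ; binary = λ _ () })

-- a forest with exactly one tree (on a nonempty label set)
record IsTree {n : ℕ} (T : Forest n) : Set where
  field
    someLeaf  : Fin n
    connected : ∀ (i j : Fin n) → i ≡ j ⊎ ∃[ c ] (c ∈ᶜ clades T × i ∈ˢ c × j ∈ˢ c)

-- the subtree rooted at the piece a of F is sent, by the map whose action on
-- inner vertices is φ, below the vertex of G with leaf-set x
MapsBelow : ∀ {n} → List (Subset n) → (Subset n → Subset n) → Subset n → Subset n → Set
MapsBelow C φ a x = a ⊆ x × (a ∈ᶜ C → φ a ⊆ x)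

-- F ≤ G: combinatorial data of a continuous map F → G satisfying (D1)-(D4):
-- φ is the action on inner vertices (D2: to inner vertices, injectively);
-- leaves are fixed (D3); each inner vertex c of F with children a, b is sent to
-- an inner vertex φ c of G with children x, y, the subtree at a going
-- (increasingly, D1) below x and the subtree at b below y (injectivity on each
-- tree, D4).
_≤F_ : ∀ {n} → Forest n → Forest n → Set
F ≤F G = Σ (Subset _ → Subset _) λ φ →
    (∀ c → c ∈ᶜ clades F → φ c ∈ᶜ clades G)
  × (∀ c c' → c ∈ᶜ clades F → c' ∈ᶜ clades F → φ c ≡ φ c' → c ≡ c')
  × (∀ c a b → c ∈ᶜ clades F → Split (clades F) c a b →
       ∃[ x ] ∃[ y ] (Split (clades G) (φ c) x y
                      × MapsBelow (clades F) φ a x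
                      × MapsBelow (clades F) φ b y))

InInterval : ∀ {n} → Forest n → Forest n → Set
InInterval T F = 𝟘 ≤F F × F ≤F T

IsJoinIn : ∀ {n} → Forest n → Forest n → Forest n → Forest n → Set
IsJoinIn T F G J = InInterval T J × F ≤F J × G ≤F J
  × (∀ K → InInterval T K → F ≤F K → G ≤F K → J ≤F K)

IsMeetIn : ∀ {n} → Forest n → Forest n → Forest n → Forest n → Set
IsMeetIn T F G M = InInterval T M × M ≤F F × M ≤F G
  × (∀ K → InInterval T K → K ≤F F → K ≤F G → K ≤F M)

IntervalIsLattice : ∀ {n} → Forest n → Set
IntervalIsLattice T = ∀ F G → InInterval T F → InInterval T G →
  (∃[ J ] IsJoinIn T F G J) × (∃[ M ] IsMeetIn T F G M)

{-# OPTIONS --safe #-}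
-- A forest F lies in [0̂, T] exactly when every clade (leaf set of an inner vertex) of F lies in a
-- clade of T and the map sending a clade to the least clade of T containing it, its T-hull, is
-- injective on the clades of F; between two such forests, F ≤ G holds exactly when every clade of F
-- lies in a clade of G, the map sending a clade to the least clade of G containing it.  So the
-- interval consists of these compatible forests ordered by refinement of clades, and it suffices to
-- build, for a family I of sets, a least compatible forest in which every member of I lies in a
-- clade.  It is the restriction of T to disjoint blocks (clades t ∩ B), where the blocks start as
-- the members of I and two blocks are merged while they overlap or their restrictions have clades
-- with the same T-hull, since every compatible forest covering both must then put them into one
-- tree.  The join of F and G is generated by the clades of F and G, the meet by the intersections
-- of a clade of F with a clade of G having at least two elements.
module Submission where

open import Defs
open import Data.Bool.Properties using () renaming (_≟_ to _≟ᵇ_)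
open import Data.Empty using (⊥; ⊥-elim)
open import Data.Fin using (Fin; _≟_)
open import Data.Fin.Subset using (Subset; ⁅_⁆; _⊆_; _∩_; _∪_; _∉_; Nonempty; ∣_∣)
  renaming (_∈_ to _∈ˢ_)
open import Data.Fin.Subset.Properties
  using ( _∈?_; _⊆?_; nonempty?; ⊆-refl; ⊆-trans; ⊆-antisym; x∈⁅x⁆; x∈⁅y⁆⇒x≡y
        ; ∣⁅x⁆∣≡1; ∣⊥∣≡0; Empty-unique; p⊆q⇒∣p∣≤∣q∣; p⊂q⇒∣p∣<∣q∣; p∩q⊆p; p∩q⊆q; x∈p∩q⁺
        ; p⊆p∪q; q⊆p∪q; x∈p∪q⁻; ∪-comm; ∩-comm; ∩-distribʳ-∪ )
open import Data.Fin.Properties using (¬∀⟶∃¬)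
open import Data.List using (List; []; _∷_; _++_; filter; cartesianProductWith; length)
open import Data.List.Membership.Propositional using (find; lose) renaming (_∈_ to _∈ᶜ_)
open import Data.List.Membership.Propositional.Properties
  using (∈-filter⁺; ∈-filter⁻; ∈-cartesianProductWith⁺; ∈-cartesianProductWith⁻; ∈-++⁺ˡ; ∈-++⁺ʳ; ∈-++⁻)
open import Data.List.Properties using (filter-notAll)
open import Data.List.Relation.Unary.All as All using (All; []; _∷_)
open import Data.List.Relation.Unary.Any as Any using (Any; here; there; any?)
open import Data.Nat using (ℕ; suc; _≤_; _<_; _≤?_; s≤s)
open import Data.Nat.Induction using (<-wellFounded)
open import Data.Nat.Properties using (≤-trans; 1+n≰n)
open import Data.Product using (∃-syntax; _×_; _,_; proj₁; proj₂)
open import Data.Sum as Sum using (_⊎_; inj₁; inj₂; [_,_]′; swap)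
open import Data.Vec.Properties using (≡-dec)
open import Function using (_∘_)
open import Induction.WellFounded using (Acc; acc)
open import Relation.Binary.PropositionalEquality
  using (_≡_; _≢_; refl; sym; trans; cong; subst; module ≡-Reasoning)
open import Relation.Nullary using (¬_; Dec; yes; no; contradiction)
open import Relation.Nullary.Decidable using (_×-dec_; _⊎-dec_; _→-dec_; ¬?; map′)

open IsForest using (size≥2; laminar; binary)

variable
  n : ℕ
  i j : Fin n
  a b c c′ d g h h′ p p′ q q′ r s t t₁ t₂ u x y z z′ B B′ : Subset n
  C D Xs Ys Zs Bs I : List (Subset n)
  F G K : Forest n

_≟ˢ_ : (p q : Subset n) → Dec (p ≡ q)
_≟ˢ_ = ≡-dec _≟ᵇ_

∪-least : p ⊆ r → q ⊆ r → p ∪ q ⊆ r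
∪-least {p = p} {q = q} p⊆r q⊆r i∈ = [ p⊆r , q⊆r ]′ (x∈p∪q⁻ p q i∈)

∩-greatest : r ⊆ p → r ⊆ q → r ⊆ p ∩ q
∩-greatest r⊆p r⊆q i∈ = x∈p∩q⁺ (r⊆p i∈ , r⊆q i∈)

∩-monoˡ : p ⊆ q → p ∩ r ⊆ q ∩ r
∩-monoˡ {p = p} {r = r} p⊆q = ∩-greatest (p⊆q ∘ p∩q⊆p p r) (p∩q⊆q p r)

⊈⇒∃∉ : ¬ p ⊆ q → ∃[ i ] (i ∈ˢ p × i ∉ q)
⊈⇒∃∉ {n} {p = p} {q = q} p⊈q
  with ¬∀⟶∃¬ n (λ i → i ∈ˢ p → i ∈ˢ q) (λ i → (i ∈? p) →-dec (i ∈? q)) (λ p⊆q → p⊈q (p⊆q _))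
... | i , ¬[i∈p⇒i∈q] with i ∈? p
...   | yes i∈p = i , i∈p , λ i∈q → ¬[i∈p⇒i∈q] (λ _ → i∈q)
...   | no i∉p = ⊥-elim (¬[i∈p⇒i∈q] (λ i∈p → contradiction i∈p i∉p))

Disjoint-elim : Disjoint p q → i ∈ˢ p → i ∈ˢ q → ⊥
Disjoint-elim p∩q=∅ i∈p i∈q = p∩q=∅ (_ , x∈p∩q⁺ (i∈p , i∈q))

Disjoint-sym : Disjoint p q → Disjoint q p
Disjoint-sym {p = p} {q = q} p∩q=∅ (i , i∈q∩p) = p∩q=∅ (i , subst (i ∈ˢ_) (∩-comm q p) i∈q∩p)

Disjoint-anti : p ⊆ p′ → q ⊆ q′ → Disjoint p′ q′ → Disjoint p q
Disjoint-anti {p = p} {q = q} p⊆p′ q⊆q′ p′∩q′=∅ (_ , i∈p∩q) =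
  Disjoint-elim p′∩q′=∅ (p⊆p′ (p∩q⊆p p q i∈p∩q)) (q⊆q′ (p∩q⊆q p q i∈p∩q))

x∈p⇒⁅x⁆⊆p : i ∈ˢ p → ⁅ i ⁆ ⊆ p
x∈p⇒⁅x⁆⊆p {i = i} i∈p j∈⁅i⁆ = subst (_∈ˢ _) (sym (x∈⁅y⁆⇒x≡y i j∈⁅i⁆)) i∈p

big⇒nonempty : 2 ≤ ∣ p ∣ → Nonempty p
big⇒nonempty {n} {p = p} 2≤∣p∣ with nonempty? p
... | yes nonempty = nonempty
... | no empty =
  contradiction (subst (2 ≤_) (∣⊥∣≡0 n) (subst (λ q → 2 ≤ ∣ q ∣) (Empty-unique empty) 2≤∣p∣)) λ ()

⊆-big : p ⊆ q → 2 ≤ ∣ p ∣ → 2 ≤ ∣ q ∣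
⊆-big p⊆q 2≤∣p∣ = ≤-trans 2≤∣p∣ (p⊆q⇒∣p∣≤∣q∣ p⊆q)

⊆⁅⁆⇒¬big : p ⊆ ⁅ i ⁆ → ¬ 2 ≤ ∣ p ∣
⊆⁅⁆⇒¬big {i = i} p⊆⁅i⁆ 2≤∣p∣ = 1+n≰n (subst (2 ≤_) (∣⁅x⁆∣≡1 i) (⊆-big p⊆⁅i⁆ 2≤∣p∣))

¬big⇒≡⁅⁆ : ¬ 2 ≤ ∣ p ∣ → i ∈ˢ p → p ≡ ⁅ i ⁆
¬big⇒≡⁅⁆ {p = p} {i = i} small i∈p = ⊆-antisym p⊆⁅i⁆ (x∈p⇒⁅x⁆⊆p i∈p)
  where
  p⊆⁅i⁆ : p ⊆ ⁅ i ⁆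
  p⊆⁅i⁆ {j} j∈p with j ≟ i
  ... | yes refl = x∈⁅x⁆ i
  ... | no j≢i = contradiction
    (subst (_< ∣ p ∣) (∣⁅x⁆∣≡1 i) (p⊂q⇒∣p∣<∣q∣ (x∈p⇒⁅x⁆⊆p i∈p , j , j∈p , j≢i ∘ x∈⁅y⁆⇒x≡y i)))
    small

big? : (p : Subset n) → Dec (2 ≤ ∣ p ∣)
big? p = 2 ≤? ∣ p ∣

any₂? : {A : Set} {P : A → A → Set} → (∀ x y → Dec (P x y)) →
        (xs ys : List A) → Dec (∃[ x ] ∃[ y ] (x ∈ᶜ xs × y ∈ᶜ ys × P x y))
any₂? {P = P} P? xs ys = map′ from to (any? (λ x → any? (P? x) ys) xs)
  where
  from : Any (λ x → Any (P x) ys) xs → ∃[ x ] ∃[ y ] (x ∈ᶜ xs × y ∈ᶜ ys × P x y)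
  from found = let (x , x∈ , found′) = find found ; (y , y∈ , Pxy) = find found′ in x , y , x∈ , y∈ , Pxy
  to : ∃[ x ] ∃[ y ] (x ∈ᶜ xs × y ∈ᶜ ys × P x y) → Any (λ x → Any (P x) ys) xs
  to (_ , _ , x∈ , y∈ , Pxy) = lose x∈ (lose y∈ Pxy)

Within : List (Subset n) → Subset n → Set
Within Xs s = ∃[ x ] (x ∈ᶜ Xs × s ⊆ x)

Refines : List (Subset n) → List (Subset n) → Set
Refines Xs Ys = ∀ {s} → s ∈ᶜ Xs → Within Ys s

Refines-refl : Refines Xs Xs
Refines-refl s∈ = _ , s∈ , ⊆-refl

Refines-trans : Refines Xs Ys → Refines Ys Zs → Refines Xs Zs
Refines-trans X⊑Y Y⊑Z s∈ =
  let (_ , y∈ , s⊆y) = X⊑Y s∈ ; (z , z∈ , y⊆z) = Y⊑Z y∈ in z , z∈ , ⊆-trans s⊆y y⊆z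

Refines-++⁺ : Refines Xs Zs → Refines Ys Zs → Refines (Xs ++ Ys) Zs
Refines-++⁺ {Xs = Xs} X⊑Z Y⊑Z s∈ = [ X⊑Z , Y⊑Z ]′ (∈-++⁻ Xs s∈)

Refines-++ˡ : Refines Xs (Xs ++ Ys)
Refines-++ˡ s∈ = _ , ∈-++⁺ˡ s∈ , ⊆-refl

Refines-++ʳ : ∀ Xs → Refines Ys (Xs ++ Ys)
Refines-++ʳ Xs s∈ = _ , ∈-++⁺ʳ Xs s∈ , ⊆-refl

bigIntersections : List (Subset n) → List (Subset n) → List (Subset n)
bigIntersections Xs Ys = filter big? (cartesianProductWith _∩_ Xs Ys)

∈-bigIntersections⁺ : x ∈ᶜ Xs → y ∈ᶜ Ys → 2 ≤ ∣ x ∩ y ∣ → x ∩ y ∈ᶜ bigIntersections Xs Ys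
∈-bigIntersections⁺ x∈ y∈ = ∈-filter⁺ big? (∈-cartesianProductWith⁺ _∩_ x∈ y∈)

∈-bigIntersections⁻ : ∀ Xs Ys → s ∈ᶜ bigIntersections Xs Ys →
                      ∃[ x ] ∃[ y ] (x ∈ᶜ Xs × y ∈ᶜ Ys × s ≡ x ∩ y)
∈-bigIntersections⁻ Xs Ys s∈ = ∈-cartesianProductWith⁻ _∩_ Xs Ys (proj₁ (∈-filter⁻ big? s∈))

bigIntersections-big : ∀ Xs Ys → s ∈ᶜ bigIntersections Xs Ys → 2 ≤ ∣ s ∣
bigIntersections-big Xs Ys s∈ = proj₂ (∈-filter⁻ big? {xs = cartesianProductWith _∩_ Xs Ys} s∈)

bigIntersections-⊑ˡ : Refines (bigIntersections Xs Ys) Xs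
bigIntersections-⊑ˡ {Xs = Xs} {Ys = Ys} s∈ with ∈-bigIntersections⁻ Xs Ys s∈
... | x , y , x∈ , _ , refl = x , x∈ , p∩q⊆p x y

bigIntersections-⊑ʳ : Refines (bigIntersections Xs Ys) Ys
bigIntersections-⊑ʳ {Xs = Xs} {Ys = Ys} s∈ with ∈-bigIntersections⁻ Xs Ys s∈
... | x , y , _ , y∈ , refl = y , y∈ , p∩q⊆q x y

Refines-bigIntersections : (∀ {s} → s ∈ᶜ Zs → 2 ≤ ∣ s ∣) →
                           Refines Zs Xs → Refines Zs Ys → Refines Zs (bigIntersections Xs Ys)
Refines-bigIntersections big Z⊑X Z⊑Y s∈ =
  let (x , x∈ , s⊆x) = Z⊑X s∈ ; (y , y∈ , s⊆y) = Z⊑Y s∈ ; s⊆x∩y = ∩-greatest s⊆x s⊆y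
  in x ∩ y , ∈-bigIntersections⁺ x∈ y∈ (⊆-big s⊆x∩y (big s∈)) , s⊆x∩y

-- Splits, nesting and hulls in a forest

split-⊆ˡ : Split C c a b → a ⊆ c
split-⊆ˡ {b = b} (_ , _ , _ , refl) = p⊆p∪q b

split-⊆ʳ : Split C c a b → b ⊆ c
split-⊆ʳ {a = a} {b = b} (_ , _ , _ , refl) = q⊆p∪q a b

split-∈ : Split C c a b → i ∈ˢ c → i ∈ˢ a ⊎ i ∈ˢ b
split-∈ {a = a} {b = b} (_ , _ , _ , refl) = x∈p∪q⁻ a b

split-least : Split C c a b → a ⊆ t → b ⊆ t → c ⊆ t
split-least (_ , _ , _ , refl) = ∪-least

split-disjoint : Split C c a b → Disjoint a b
split-disjoint (_ , _ , a∩b=∅ , _) = a∩b=∅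

split-sym : Split C c a b → Split C c b a
split-sym {a = a} {b = b} (pa , pb , a∩b=∅ , refl) = pb , pa , Disjoint-sym a∩b=∅ , ∪-comm b a

piece-nonempty : IsForest C → Piece C p → Nonempty p
piece-nonempty W (inj₁ p∈) = big⇒nonempty (size≥2 W _ p∈)
piece-nonempty W (inj₂ (i , refl)) = i , x∈⁅x⁆ i

split-≢ˡ : IsForest C → Split C c a b → a ≢ c
split-≢ˡ W sp@(_ , pb , a∩b=∅ , _) refl =
  let (j , j∈b) = piece-nonempty W pb in Disjoint-elim a∩b=∅ (split-⊆ʳ sp j∈b) j∈b

nest : IsForest C → c ∈ᶜ C → d ∈ᶜ C → i ∈ˢ c → i ∈ˢ d → c ⊆ d ⊎ d ⊆ c
nest W c∈ d∈ i∈c i∈d with laminar W _ _ c∈ d∈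
... | inj₁ c⊆d = inj₁ c⊆d
... | inj₂ (inj₁ d⊆c) = inj₂ d⊆c
... | inj₂ (inj₂ c∩d=∅) = ⊥-elim (Disjoint-elim c∩d=∅ i∈c i∈d)

piece-nest : IsForest C → Piece C p → c ∈ᶜ C → i ∈ˢ p → i ∈ˢ c → p ⊆ c ⊎ c ⊆ p
piece-nest W (inj₁ p∈) c∈ = nest W p∈ c∈
piece-nest W (inj₂ (j , refl)) c∈ i∈⁅j⁆ i∈c =
  inj₁ (x∈p⇒⁅x⁆⊆p (subst (_∈ˢ _) (x∈⁅y⁆⇒x≡y j i∈⁅j⁆) i∈c))

within-∪ : IsForest C → c ∈ᶜ C → d ∈ᶜ C → Nonempty (c ∩ d) → p ⊆ c → q ⊆ d → Within C (p ∪ q)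
within-∪ {c = c} {d = d} W c∈ d∈ (_ , i∈c∩d) p⊆c q⊆d
  with nest W c∈ d∈ (p∩q⊆p c d i∈c∩d) (p∩q⊆q c d i∈c∩d)
... | inj₁ c⊆d = d , d∈ , ∪-least (⊆-trans p⊆c c⊆d) q⊆d
... | inj₂ d⊆c = c , c∈ , ∪-least p⊆c (⊆-trans q⊆d d⊆c)

subclade-⊆-child : IsForest C → Split C c x y → u ∈ᶜ C → u ⊆ c → u ≢ c → u ⊆ x ⊎ u ⊆ y
subclade-⊆-child {C = C} {c = c} {x = x} {y = y} {u = u} W sp u∈ u⊆c u≢c with u ⊆? x | u ⊆? y
... | yes u⊆x | _ = inj₁ u⊆x
... | no _ | yes u⊆y = inj₂ u⊆y
... | no u⊈x | no u⊈y =
  contradiction (⊆-antisym u⊆c (split-least sp (child⊆u sp u⊈y u⊈x) (child⊆u (split-sym sp) u⊈x u⊈y)))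
                u≢c
  where
  -- A point of u outside z′ lies in z, so z and u are nested, and u ⊈ z.
  child⊆u : Split C c z z′ → ¬ u ⊆ z′ → ¬ u ⊆ z → z ⊆ u
  child⊆u sp′@(pz , _) u⊈z′ u⊈z with ⊈⇒∃∉ u⊈z′
  ... | j , j∈u , j∉z′ with split-∈ sp′ (u⊆c j∈u)
  ...   | inj₂ j∈z′ = contradiction j∈z′ j∉z′
  ...   | inj₁ j∈z with piece-nest W pz u∈ j∈z j∈u
  ...     | inj₁ z⊆u = z⊆u
  ...     | inj₂ u⊆z = ⊥-elim (u⊈z u⊆z)

meets-children⇒⊇ : IsForest C → Split C h x y → h ∈ᶜ C → g ∈ᶜ C →
                   i ∈ˢ g → i ∈ˢ x → j ∈ˢ g → j ∈ˢ y → h ⊆ g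
meets-children⇒⊇ {h = h} {g = g} W sp h∈ g∈ i∈g i∈x j∈g j∈y with nest W h∈ g∈ (split-⊆ˡ sp i∈x) i∈g
... | inj₁ h⊆g = h⊆g
... | inj₂ g⊆h with g ≟ˢ h
...   | yes refl = ⊆-refl
...   | no g≢h with subclade-⊆-child W sp g∈ g⊆h g≢h
...     | inj₁ g⊆x = ⊥-elim (Disjoint-elim (split-disjoint sp) (g⊆x j∈g) j∈y)
...     | inj₂ g⊆y = ⊥-elim (Disjoint-elim (split-disjoint sp) i∈x (g⊆y i∈g))

split-⊈ʳ⇒meetsˡ : Split C h x y → s ⊆ h → ¬ s ⊆ y → ∃[ i ] (i ∈ˢ s × i ∈ˢ x)
split-⊈ʳ⇒meetsˡ sp s⊆h s⊈y with ⊈⇒∃∉ s⊈y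
... | i , i∈s , i∉y with split-∈ sp (s⊆h i∈s)
...   | inj₁ i∈x = i , i∈s , i∈x
...   | inj₂ i∈y = contradiction i∈y i∉y

⊆-remaining-child : Split C g x y → Disjoint t₁ t₂ → y ⊆ t₂ → s ⊆ g → s ⊆ t₁ → s ⊆ x
⊆-remaining-child sp t₁∩t₂=∅ y⊆t₂ s⊆g s⊆t₁ i∈s with split-∈ sp (s⊆g i∈s)
... | inj₁ i∈x = i∈x
... | inj₂ i∈y = ⊥-elim (Disjoint-elim t₁∩t₂=∅ (s⊆t₁ i∈s) (y⊆t₂ i∈y))

Separated : (a b t₁ t₂ : Subset n) → Set
Separated a b t₁ t₂ = (a ⊆ t₁ × b ⊆ t₂) ⊎ (a ⊆ t₂ × b ⊆ t₁)

side⇒⊆-child : Split C g x y → Disjoint t₁ t₂ → Separated x y t₁ t₂ → s ⊆ g → s ⊆ t₁ → s ⊆ x ⊎ s ⊆ y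
side⇒⊆-child sp d (inj₁ (_ , y⊆t₂)) s⊆g s⊆t₁ = inj₁ (⊆-remaining-child sp d y⊆t₂ s⊆g s⊆t₁)
side⇒⊆-child sp d (inj₂ (x⊆t₂ , _)) s⊆g s⊆t₁ = inj₂ (⊆-remaining-child (split-sym sp) d x⊆t₂ s⊆g s⊆t₁)

aligned-children-match : Split C g x y → Disjoint t₁ t₂ → x ⊆ t₁ → y ⊆ t₂ → Separated a b t₁ t₂ →
                         a ⊆ g → b ⊆ g → (a ⊆ x × b ⊆ y) ⊎ (a ⊆ y × b ⊆ x)
aligned-children-match sp d x⊆t₁ y⊆t₂ (inj₁ (a⊆t₁ , b⊆t₂)) a⊆g b⊆g =
  inj₁ ( ⊆-remaining-child sp d y⊆t₂ a⊆g a⊆t₁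
       , ⊆-remaining-child (split-sym sp) (Disjoint-sym d) x⊆t₁ b⊆g b⊆t₂ )
aligned-children-match sp d x⊆t₁ y⊆t₂ (inj₂ (a⊆t₂ , b⊆t₁)) a⊆g b⊆g =
  inj₂ ( ⊆-remaining-child (split-sym sp) (Disjoint-sym d) x⊆t₁ a⊆g a⊆t₂
       , ⊆-remaining-child sp d y⊆t₂ b⊆g b⊆t₁ )

separated-children-match : Split C g x y → Disjoint t₁ t₂ → Separated x y t₁ t₂ → Separated a b t₁ t₂ →
                           a ⊆ g → b ⊆ g → (a ⊆ x × b ⊆ y) ⊎ (a ⊆ y × b ⊆ x)
separated-children-match sp d (inj₁ (x⊆t₁ , y⊆t₂)) = aligned-children-match sp d x⊆t₁ y⊆t₂
separated-children-match sp d (inj₂ (x⊆t₂ , y⊆t₁)) =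
  aligned-children-match sp (Disjoint-sym d) x⊆t₂ y⊆t₁ ∘ swap

record IsHull (C : List (Subset n)) (s h : Subset n) : Set where
  field
    member   : h ∈ᶜ C
    contains : s ⊆ h
    least    : ∀ {c} → c ∈ᶜ C → s ⊆ c → h ⊆ c
open IsHull public

IsHull-unique : IsHull C s h → IsHull C s h′ → h ≡ h′
IsHull-unique H H′ = ⊆-antisym (least H (member H′) (contains H′)) (least H′ (member H) (contains H))

IsHull-refl : c ∈ᶜ C → IsHull C c c
IsHull-refl c∈ = record { member = c∈ ; contains = ⊆-refl ; least = λ _ c⊆ → c⊆ }

LeastAmong : List (Subset n) → Subset n → Subset n → Set
LeastAmong Xs s h = s ⊆ h × All (λ c → s ⊆ c → h ⊆ c) Xs

leastAmong? : ∀ Xs (s h : Subset n) → Dec (LeastAmong Xs s h)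
leastAmong? Xs s h = (s ⊆? h) ×-dec All.all? (λ c → (s ⊆? c) →-dec (h ⊆? c)) Xs

-- The fallback s is a junk value: hull-isHull applies only when some clade contains s.
hull : List (Subset n) → Subset n → Subset n
hull C s with any? (leastAmong? C s) C
... | yes found = proj₁ (find found)
... | no _ = s

-- The clades containing s share a point of s, so they are nested and a running minimum exists.
leastAmong-exists : IsForest C → i ∈ˢ s → Within C s → (Xs : List (Subset n)) →
                    (∀ {c} → c ∈ᶜ Xs → c ∈ᶜ C) → ∃[ h ] (h ∈ᶜ C × LeastAmong Xs s h)
leastAmong-exists W i∈s (h , h∈ , s⊆h) [] _ = h , h∈ , s⊆h , []
leastAmong-exists {s = s} W i∈s within (c ∷ Xs) Xs⊆C
  with leastAmong-exists W i∈s within Xs (Xs⊆C ∘ there)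
... | h , h∈ , s⊆h , minimal with s ⊆? c
...   | no s⊈c = h , h∈ , s⊆h , (λ s⊆c → ⊥-elim (s⊈c s⊆c)) ∷ minimal
...   | yes s⊆c with nest W h∈ (Xs⊆C (here refl)) (s⊆h i∈s) (s⊆c i∈s)
...     | inj₁ h⊆c = h , h∈ , s⊆h , (λ _ → h⊆c) ∷ minimal
...     | inj₂ c⊆h = c , Xs⊆C (here refl) , s⊆c ,
                     (λ _ → ⊆-refl) ∷ All.map shrink minimal
  where
  shrink : (s ⊆ c′ → h ⊆ c′) → s ⊆ c′ → c ⊆ c′
  shrink h-least s⊆c′ = ⊆-trans c⊆h (h-least s⊆c′)

hull-isHull : IsForest C → Nonempty s → Within C s → IsHull C s (hull C s)
hull-isHull {C = C} {s = s} W (i , i∈s) within with any? (leastAmong? C s) C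
... | yes found with find found
...   | h , h∈ , s⊆h , minimal =
  record { member = h∈ ; contains = s⊆h ; least = λ c∈ → All.lookup minimal c∈ }
hull-isHull {C = C} {s = s} W (i , i∈s) within | no none =
  let (_ , h∈ , leastAmong) = leastAmong-exists W i∈s within C (λ c∈ → c∈)
  in ⊥-elim (none (lose h∈ leastAmong))

hull-⊈-child : IsForest C → IsHull C s h → Split C h x y → 2 ≤ ∣ s ∣ → ¬ s ⊆ x
hull-⊈-child W H (inj₂ (j , refl) , _) 2≤∣s∣ s⊆x = ⊆⁅⁆⇒¬big s⊆x 2≤∣s∣
hull-⊈-child W H sp@(inj₁ x∈ , py , x∩y=∅ , _) 2≤∣s∣ s⊆x =
  let (j , j∈y) = piece-nonempty W py in Disjoint-elim x∩y=∅ (least H x∈ s⊆x (split-⊆ʳ sp j∈y)) j∈y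

hull-mapsBelow : IsForest D → IsForest C → Piece C z → p ⊆ z → MapsBelow D (hull C) p z
hull-mapsBelow WD WC (inj₁ z∈) p⊆z =
  p⊆z , λ p∈ → least (hull-isHull WC (big⇒nonempty (size≥2 WD _ p∈)) (_ , z∈ , p⊆z)) z∈ p⊆z
hull-mapsBelow WD WC (inj₂ (i , refl)) p⊆z =
  p⊆z , λ p∈ → ⊥-elim (⊆⁅⁆⇒¬big p⊆z (size≥2 WD _ p∈))

𝟘≤F : 𝟘 ≤F F
𝟘≤F = (λ s → s) , (λ _ ()) , (λ _ _ ()) , (λ _ _ _ ())

≤F-⊆ : ∀ (F G : Forest n) (F≤G : F ≤F G) → c ∈ᶜ clades F → c ⊆ proj₁ F≤G c
≤F-⊆ F G (_ , _ , _ , splits) c∈ with binary (wf F) _ c∈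
... | a , b , spF with splits _ a b c∈ spF
...   | _ , _ , spG , (a⊆x , _) , (b⊆y , _) =
  split-least spF (⊆-trans a⊆x (split-⊆ˡ spG)) (⊆-trans b⊆y (split-⊆ʳ spG))

≤F⇒Refines : ∀ (F G : Forest n) → F ≤F G → Refines (clades F) (clades G)
≤F⇒Refines F G F≤G@(φ , φ∈ , _) {c} c∈ = φ c , φ∈ c c∈ , ≤F-⊆ F G F≤G c∈

-- The image of c has children containing those of c, so any clade containing c meets both of them.
≤F-isHull : ∀ (F G : Forest n) (F≤G : F ≤F G) → c ∈ᶜ clades F → IsHull (clades G) c (proj₁ F≤G c)
≤F-isHull {c = c} F G F≤G@(φ , φ∈ , _ , splits) c∈ =
  record { member = φ∈ c c∈ ; contains = ≤F-⊆ F G F≤G c∈ ; least = φc-least }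
  where
  φc-least : g ∈ᶜ clades G → c ⊆ g → φ c ⊆ g
  φc-least g∈ c⊆g with binary (wf F) _ c∈
  ... | a , b , spF@(pa , pb , _)
    with splits _ a b c∈ spF | piece-nonempty (wf F) pa | piece-nonempty (wf F) pb
  ...   | _ , _ , spG , (a⊆x , _) , (b⊆y , _) | i , i∈a | j , j∈b =
    meets-children⇒⊇ (wf G) spG (φ∈ c c∈) g∈
      (c⊆g (split-⊆ˡ spF i∈a)) (a⊆x i∈a) (c⊆g (split-⊆ʳ spF j∈b)) (b⊆y j∈b)

PairwiseDisjoint : List (Subset n) → Set
PairwiseDisjoint Bs = ∀ {B B′} → B ∈ᶜ Bs → B′ ∈ᶜ Bs → B ≡ B′ ⊎ Disjoint B B′

remove : Subset n → List (Subset n) → List (Subset n)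
remove B = filter (λ B′ → ¬? (B′ ≟ˢ B))

∈-remove⁺ : B′ ∈ᶜ Bs → B′ ≢ B → B′ ∈ᶜ remove B Bs
∈-remove⁺ {B = B} = ∈-filter⁺ (λ B′ → ¬? (B′ ≟ˢ B))

∈-remove⁻ : B′ ∈ᶜ remove B Bs → B′ ∈ᶜ Bs
∈-remove⁻ {B = B} = proj₁ ∘ ∈-filter⁻ (λ B′ → ¬? (B′ ≟ˢ B))

length-remove : B ∈ᶜ Bs → length (remove B Bs) < length Bs
length-remove {B = B} {Bs = Bs} B∈ =
  filter-notAll (λ B′ → ¬? (B′ ≟ˢ B)) Bs (Any.map (λ B≡B′ B′≢B → B′≢B (sym B≡B′)) B∈)

merge : Subset n → Subset n → List (Subset n) → List (Subset n)
merge B B′ Bs = (B ∪ B′) ∷ remove B′ (remove B Bs)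

length-merge : B ∈ᶜ Bs → B′ ∈ᶜ Bs → B ≢ B′ → length (merge B B′ Bs) < length Bs
length-merge B∈ B′∈ B≢B′ = ≤-trans (s≤s (length-remove (∈-remove⁺ B′∈ (B≢B′ ∘ sym)))) (length-remove B∈)

Refines-merge : Refines Bs (merge B B′ Bs)
Refines-merge {B = B} {B′ = B′} {s = s} s∈ with s ≟ˢ B | s ≟ˢ B′
... | yes refl | _ = B ∪ B′ , here refl , p⊆p∪q B′
... | no _ | yes refl = B ∪ B′ , here refl , q⊆p∪q B B′
... | no s≢B | no s≢B′ = s , there (∈-remove⁺ (∈-remove⁺ s∈ s≢B) s≢B′) , ⊆-refl

-- Forests compatible with T

module Interval {n : ℕ} (T : Forest n) where

  hullT : Subset n → Subset n
  hullT = hull (clades T)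

  hullT-isHull : 2 ≤ ∣ s ∣ → Within (clades T) s → IsHull (clades T) s (hullT s)
  hullT-isHull 2≤∣s∣ = hull-isHull (wf T) (big⇒nonempty 2≤∣s∣)

  -- By ≤F⇒Compatible and Compatible⇒InInterval, these are exactly the forests of [0̂, T].
  record Compatible (K : Forest n) : Set where
    field
      refines         : Refines (clades K) (clades T)
      hullT-injective : ∀ {c c′} → c ∈ᶜ clades K → c′ ∈ᶜ clades K → hullT c ≡ hullT c′ → c ≡ c′
  open Compatible

  clade-hullT : Compatible K → c ∈ᶜ clades K → IsHull (clades T) c (hullT c)
  clade-hullT {K = K} cK c∈ = hullT-isHull (size≥2 (wf K) _ c∈) (refines cK c∈)

  compatible-T : Compatible T
  compatible-T = record { refines = Refines-refl ; hullT-injective = injective }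
    where
    hullT-self : c ∈ᶜ clades T → hullT c ≡ c
    hullT-self c∈ = IsHull-unique (hullT-isHull (size≥2 (wf T) _ c∈) (_ , c∈ , ⊆-refl)) (IsHull-refl c∈)
    injective : c ∈ᶜ clades T → c′ ∈ᶜ clades T → hullT c ≡ hullT c′ → c ≡ c′
    injective c∈ c′∈ eq = trans (sym (hullT-self c∈)) (trans eq (hullT-self c′∈))

  ≤F⇒Compatible : ∀ F → F ≤F T → Compatible F
  ≤F⇒Compatible F F≤T@(φ , _ , φ-injective , _) =
    record { refines = ≤F⇒Refines F T F≤T ; hullT-injective = injective }
    where
    φ≡hullT : c ∈ᶜ clades F → φ c ≡ hullT c
    φ≡hullT c∈ = IsHull-unique (≤F-isHull F T F≤T c∈)
                               (hullT-isHull (size≥2 (wf F) _ c∈) (≤F⇒Refines F T F≤T c∈))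
    injective : c ∈ᶜ clades F → c′ ∈ᶜ clades F → hullT c ≡ hullT c′ → c ≡ c′
    injective c∈ c′∈ eq = φ-injective _ _ c∈ c′∈ (trans (φ≡hullT c∈) (trans eq (sym (φ≡hullT c′∈))))

  piece-⊆-child : Compatible K → c ∈ᶜ clades K → Piece (clades K) p → p ⊆ c → p ≢ c →
                  Split (clades T) (hullT c) t₁ t₂ → p ⊆ t₁ ⊎ p ⊆ t₂
  piece-⊆-child cK c∈ (inj₂ (i , refl)) p⊆c _ spT =
    Sum.map x∈p⇒⁅x⁆⊆p x∈p⇒⁅x⁆⊆p (split-∈ spT (contains (clade-hullT cK c∈) (p⊆c (x∈⁅x⁆ i))))
  piece-⊆-child cK c∈ (inj₁ p∈) p⊆c p≢c spT =
    Sum.map (⊆-trans (contains Hp)) (⊆-trans (contains Hp))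
      (subclade-⊆-child (wf T) spT (member Hp) (least Hp (member Hc) (⊆-trans p⊆c (contains Hc)))
                        (p≢c ∘ hullT-injective cK p∈ c∈))
    where
    Hp = clade-hullT cK p∈
    Hc = clade-hullT cK c∈

  -- Each child lies in one child of hullT c, since its own T-hull is a proper subclade by
  -- injectivity; both lying in the same one would contradict the minimality of hullT c.
  children-separated : Compatible K → c ∈ᶜ clades K → Split (clades K) c a b →
                       Split (clades T) (hullT c) t₁ t₂ → Separated a b t₁ t₂
  children-separated {K = K} cK c∈ sp@(pa , pb , _) spT
    with piece-⊆-child cK c∈ pa (split-⊆ˡ sp) (split-≢ˡ (wf K) sp) spT
       | piece-⊆-child cK c∈ pb (split-⊆ʳ sp) (split-≢ˡ (wf K) (split-sym sp)) spT
  ... | inj₁ a⊆t₁ | inj₂ b⊆t₂ = inj₁ (a⊆t₁ , b⊆t₂)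
  ... | inj₂ a⊆t₂ | inj₁ b⊆t₁ = inj₂ (a⊆t₂ , b⊆t₁)
  ... | inj₁ a⊆t₁ | inj₁ b⊆t₁ =
    ⊥-elim (hull-⊈-child (wf T) (clade-hullT cK c∈) spT (size≥2 (wf K) _ c∈)
                         (split-least sp a⊆t₁ b⊆t₁))
  ... | inj₂ a⊆t₂ | inj₂ b⊆t₂ =
    ⊥-elim (hull-⊈-child (wf T) (clade-hullT cK c∈) (split-sym spT) (size≥2 (wf K) _ c∈)
                         (split-least sp a⊆t₂ b⊆t₂))

  hullT-preserved : Compatible K → IsHull (clades K) s g → 2 ≤ ∣ s ∣ → hullT g ≡ hullT s
  hullT-preserved {K = K} {s = s} {g = g} cK H 2≤∣s∣
    with hullT g ≟ˢ hullT s | binary (wf K) g (member H)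
       | binary (wf T) (hullT g) (member (clade-hullT cK (member H)))
  ... | yes eq | _ | _ = eq
  ... | no neq | x , y , spK | t₁ , t₂ , spT =
    ⊥-elim ([ hull-⊈-child (wf K) H spK 2≤∣s∣ , hull-⊈-child (wf K) H (split-sym spK) 2≤∣s∣ ]′ s⊆child)
    where
    Hg = clade-hullT cK (member H)
    s⊆hullTg = ⊆-trans (contains H) (contains Hg)
    Hs = hullT-isHull 2≤∣s∣ (hullT g , member Hg , s⊆hullTg)
    separated = children-separated cK (member H) spK spT
    t₁∩t₂=∅ = split-disjoint spT
    s⊆child : s ⊆ x ⊎ s ⊆ y
    s⊆child with subclade-⊆-child (wf T) spT (member Hs) (least Hs (member Hg) s⊆hullTg) (neq ∘ sym)
    ... | inj₁ hs⊆t₁ =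
      side⇒⊆-child spK t₁∩t₂=∅ separated (contains H) (⊆-trans (contains Hs) hs⊆t₁)
    ... | inj₂ hs⊆t₂ =
      side⇒⊆-child spK (Disjoint-sym t₁∩t₂=∅) (swap separated) (contains H) (⊆-trans (contains Hs) hs⊆t₂)

  hull-preserves-split : Compatible F → Compatible G → c ∈ᶜ clades F → IsHull (clades G) c g →
                         hullT g ≡ hullT c → Split (clades F) c a b →
                         ∃[ x ] ∃[ y ] (Split (clades G) g x y × a ⊆ x × b ⊆ y)
  hull-preserves-split {G = G} {g = g} cF cG c∈ H eq spF
    with binary (wf G) g (member H) | binary (wf T) (hullT g) (member (clade-hullT cG (member H)))
  ... | x , y , spG | t₁ , t₂ , spT
    with separated-children-match spG (split-disjoint spT) (children-separated cG (member H) spG spT)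
           (children-separated cF c∈ spF (subst (λ h → Split (clades T) h t₁ t₂) eq spT))
           (⊆-trans (split-⊆ˡ spF) (contains H)) (⊆-trans (split-⊆ʳ spF) (contains H))
  ... | inj₁ (a⊆x , b⊆y) = x , y , spG , a⊆x , b⊆y
  ... | inj₂ (a⊆y , b⊆x) = y , x , split-sym spG , a⊆y , b⊆x

  Refines⇒≤F : Compatible F → Compatible G → Refines (clades F) (clades G) → F ≤F G
  Refines⇒≤F {F = F} {G = G} cF cG F⊑G =
    hull (clades G) , (λ _ c∈ → member (H c∈)) , injective , splits
    where
    H : c ∈ᶜ clades F → IsHull (clades G) c (hull (clades G) c)
    H c∈ = hull-isHull (wf G) (big⇒nonempty (size≥2 (wf F) _ c∈)) (F⊑G c∈)
    hullT-hull : c ∈ᶜ clades F → hullT (hull (clades G) c) ≡ hullT c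
    hullT-hull c∈ = hullT-preserved cG (H c∈) (size≥2 (wf F) _ c∈)
    injective : ∀ c c′ → c ∈ᶜ clades F → c′ ∈ᶜ clades F →
                hull (clades G) c ≡ hull (clades G) c′ → c ≡ c′
    injective c c′ c∈ c′∈ eq =
      hullT-injective cF c∈ c′∈ (trans (sym (hullT-hull c∈)) (trans (cong hullT eq) (hullT-hull c′∈)))
    splits : ∀ c a b → c ∈ᶜ clades F → Split (clades F) c a b →
             ∃[ x ] ∃[ y ] (Split (clades G) (hull (clades G) c) x y
                            × MapsBelow (clades F) (hull (clades G)) a x
                            × MapsBelow (clades F) (hull (clades G)) b y)
    splits c a b c∈ spF with hull-preserves-split cF cG c∈ (H c∈) (hullT-hull c∈) spF
    ... | x , y , spG@(px , py , _) , a⊆x , b⊆y =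
      x , y , spG , hull-mapsBelow (wf F) (wf G) px a⊆x , hull-mapsBelow (wf F) (wf G) py b⊆y

  InInterval⇒Compatible : ∀ F → InInterval T F → Compatible F
  InInterval⇒Compatible F = ≤F⇒Compatible F ∘ proj₂

  Compatible⇒InInterval : Compatible F → InInterval T F
  Compatible⇒InInterval {F = F} cF = 𝟘≤F {F = F} , Refines⇒≤F cF compatible-T (refines cF)

  -- Restricting T to disjoint blocks

  hullT-∩ : t ∈ᶜ clades T → 2 ≤ ∣ t ∩ B ∣ → hullT (t ∩ B) ∩ B ≡ t ∩ B
  hullT-∩ {t = t} {B = B} t∈ 2≤∣t∩B∣ =
    ⊆-antisym (∩-monoˡ (least H t∈ (p∩q⊆p t B))) (∩-greatest (contains H) (p∩q⊆q t B))
    where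
    H = hullT-isHull 2≤∣t∩B∣ (t , t∈ , p∩q⊆p t B)

  restrict-laminar : PairwiseDisjoint Bs → c ∈ᶜ bigIntersections (clades T) Bs →
                     d ∈ᶜ bigIntersections (clades T) Bs → c ⊆ d ⊎ d ⊆ c ⊎ Disjoint c d
  restrict-laminar {Bs = Bs} disjoint c∈ d∈
    with ∈-bigIntersections⁻ (clades T) Bs c∈ | ∈-bigIntersections⁻ (clades T) Bs d∈
  ... | t , B , t∈ , B∈ , refl | t′ , B′ , t′∈ , B′∈ , refl with disjoint B∈ B′∈
  ...   | inj₂ B∩B′=∅ = inj₂ (inj₂ (Disjoint-anti (p∩q⊆q t B) (p∩q⊆q t′ B′) B∩B′=∅))
  ...   | inj₁ refl with laminar (wf T) t t′ t∈ t′∈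
  ...     | inj₁ t⊆t′ = inj₁ (∩-monoˡ t⊆t′)
  ...     | inj₂ (inj₁ t′⊆t) = inj₂ (inj₁ (∩-monoˡ t′⊆t))
  ...     | inj₂ (inj₂ t∩t′=∅) = inj₂ (inj₂ (Disjoint-anti (p∩q⊆p t B) (p∩q⊆p t′ B) t∩t′=∅))

  restrict-piece : B ∈ᶜ Bs → Piece (clades T) p → Nonempty (p ∩ B) →
                   Piece (bigIntersections (clades T) Bs) (p ∩ B)
  restrict-piece {B = B} {p = p} B∈ piece (i , i∈) with big? (p ∩ B) | piece
  ... | no small | _ = inj₂ (i , ¬big⇒≡⁅⁆ small i∈)
  ... | yes 2≤∣p∩B∣ | inj₁ p∈ = inj₁ (∈-bigIntersections⁺ p∈ B∈ 2≤∣p∩B∣)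
  ... | yes 2≤∣p∩B∣ | inj₂ (j , refl) = ⊥-elim (⊆⁅⁆⇒¬big (p∩q⊆p ⁅ j ⁆ B) 2≤∣p∩B∣)

  -- The children of the hull of s, restricted to B, both meet s since s lies in neither of them.
  hull-split-restricts : B ∈ᶜ Bs → 2 ≤ ∣ s ∣ → s ⊆ B → IsHull (clades T) s h → h ∩ B ≡ s →
                         ∃[ a ] ∃[ b ] Split (bigIntersections (clades T) Bs) s a b
  hull-split-restricts {B = B} {s = s} {h = h} B∈ 2≤∣s∣ s⊆B H h∩B≡s
    with binary (wf T) h (member H)
  ... | h₁ , h₂ , spT@(p₁ , p₂ , h₁∩h₂=∅ , h₁∪h₂≡h) =
    h₁ ∩ B , h₂ ∩ B , restrict-piece B∈ p₁ (meets spT) , restrict-piece B∈ p₂ (meets (split-sym spT)) ,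
    Disjoint-anti (p∩q⊆p h₁ B) (p∩q⊆p h₂ B) h₁∩h₂=∅ , union
    where
    meets : Split (clades T) h x y → Nonempty (x ∩ B)
    meets sp =
      let (i , i∈s , i∈x) = split-⊈ʳ⇒meetsˡ sp (contains H) (hull-⊈-child (wf T) H (split-sym sp) 2≤∣s∣)
      in i , x∈p∩q⁺ (i∈x , s⊆B i∈s)
    open ≡-Reasoning
    union : (h₁ ∩ B) ∪ (h₂ ∩ B) ≡ s
    union = begin
      (h₁ ∩ B) ∪ (h₂ ∩ B) ≡⟨ ∩-distribʳ-∪ B h₁ h₂ ⟨
      (h₁ ∪ h₂) ∩ B       ≡⟨ cong (_∩ B) h₁∪h₂≡h ⟩
      h ∩ B               ≡⟨ h∩B≡s ⟩
      s                   ∎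

  restrict-binary : c ∈ᶜ bigIntersections (clades T) Bs →
                    ∃[ a ] ∃[ b ] Split (bigIntersections (clades T) Bs) c a b
  restrict-binary {Bs = Bs} c∈
    with ∈-bigIntersections⁻ (clades T) Bs c∈ | bigIntersections-big (clades T) Bs c∈
  ... | t , B , t∈ , B∈ , refl | 2≤∣t∩B∣ =
    hull-split-restricts B∈ 2≤∣t∩B∣ (p∩q⊆q t B) (hullT-isHull 2≤∣t∩B∣ (t , t∈ , p∩q⊆p t B))
                         (hullT-∩ t∈ 2≤∣t∩B∣)

  restrict : (Bs : List (Subset n)) → PairwiseDisjoint Bs → Forest n
  restrict Bs disjoint = forest (bigIntersections (clades T) Bs) record
    { size≥2  = λ _ → bigIntersections-big (clades T) Bs
    ; laminar = λ _ _ → restrict-laminar disjoint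
    ; binary  = λ _ → restrict-binary
    }

  -- Merging blocks

  Conflict : Subset n → Subset n → Set
  Conflict B B′ = ∃[ t ] ∃[ t′ ] (t ∈ᶜ clades T × t′ ∈ᶜ clades T ×
                    2 ≤ ∣ t ∩ B ∣ × 2 ≤ ∣ t′ ∩ B′ ∣ × hullT (t ∩ B) ≡ hullT (t′ ∩ B′))

  conflict? : ∀ B B′ → Dec (Conflict B B′)
  conflict? B B′ =
    any₂? (λ t t′ → big? (t ∩ B) ×-dec big? (t′ ∩ B′) ×-dec (hullT (t ∩ B) ≟ˢ hullT (t′ ∩ B′)))
          (clades T) (clades T)

  ConflictFree : List (Subset n) → Set
  ConflictFree Bs = ∀ {B B′} → B ∈ᶜ Bs → B′ ∈ᶜ Bs → B ≢ B′ → ¬ Conflict B B′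

  restrict-compatible : (disjoint : PairwiseDisjoint Bs) → ConflictFree Bs →
                        Compatible (restrict Bs disjoint)
  restrict-compatible {Bs = Bs} _ conflictFree =
    record { refines = bigIntersections-⊑ˡ ; hullT-injective = injective }
    where
    injective : c ∈ᶜ bigIntersections (clades T) Bs → c′ ∈ᶜ bigIntersections (clades T) Bs →
                hullT c ≡ hullT c′ → c ≡ c′
    injective c∈ c′∈ eq
      with ∈-bigIntersections⁻ (clades T) Bs c∈ | bigIntersections-big (clades T) Bs c∈
         | ∈-bigIntersections⁻ (clades T) Bs c′∈ | bigIntersections-big (clades T) Bs c′∈
    ... | t , B , t∈ , B∈ , refl | big | t′ , B′ , t′∈ , B′∈ , refl | big′ with B ≟ˢ B′
    ...   | no B≢B′ = ⊥-elim (conflictFree B∈ B′∈ B≢B′ (t , t′ , t∈ , t′∈ , big , big′ , eq))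
    ...   | yes refl = begin
      t ∩ B               ≡⟨ hullT-∩ t∈ big ⟨
      hullT (t ∩ B) ∩ B   ≡⟨ cong (_∩ B) eq ⟩
      hullT (t′ ∩ B) ∩ B  ≡⟨ hullT-∩ t′∈ big′ ⟩
      t′ ∩ B              ∎
      where open ≡-Reasoning

  Linked : Subset n → Subset n → Set
  Linked B B′ = Nonempty (B ∩ B′) ⊎ Conflict B B′

  -- The K-hulls of t ∩ B and t′ ∩ B′ have the same T-hull, hence coincide by injectivity,
  -- so a point of t′ ∩ B′ lies in both c and c′.
  conflict⇒meets : Compatible K → c ∈ᶜ clades K → c′ ∈ᶜ clades K → B ⊆ c → B′ ⊆ c′ →
                   Conflict B B′ → Nonempty (c ∩ c′)
  conflict⇒meets {K = K} {B = B} {B′ = B′} cK c∈ c′∈ B⊆c B′⊆c′ (t , t′ , _ , _ , big , big′ , eq)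
    with big⇒nonempty big′
  ... | i , i∈ =
    i , x∈p∩q⁺ (least H c∈ t∩B⊆c (subst (i ∈ˢ_) (sym u≡u′) (contains H′ i∈)) , B′⊆c′ (p∩q⊆q t′ B′ i∈))
    where
    t∩B⊆c = ⊆-trans (p∩q⊆q t B) B⊆c
    H = hull-isHull (wf K) (big⇒nonempty big) (_ , c∈ , t∩B⊆c)
    H′ = hull-isHull (wf K) (big⇒nonempty big′) (_ , c′∈ , ⊆-trans (p∩q⊆q t′ B′) B′⊆c′)
    u≡u′ = hullT-injective cK (member H) (member H′)
             (trans (hullT-preserved cK H big) (trans eq (sym (hullT-preserved cK H′ big′))))

  Linked-within : Compatible K → Within (clades K) B → Within (clades K) B′ → Linked B B′ →
                  Within (clades K) (B ∪ B′)
  Linked-within {K = K} {B = B} {B′ = B′} cK (c , c∈ , B⊆c) (c′ , c′∈ , B′⊆c′) linked =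
    within-∪ (wf K) c∈ c′∈ ([ meet , conflict⇒meets cK c∈ c′∈ B⊆c B′⊆c′ ]′ linked) B⊆c B′⊆c′
    where
    meet : Nonempty (B ∩ B′) → Nonempty (c ∩ c′)
    meet (i , i∈) = i , x∈p∩q⁺ (B⊆c (p∩q⊆p B B′ i∈) , B′⊆c′ (p∩q⊆q B B′ i∈))

  Forced : List (Subset n) → List (Subset n) → Set
  Forced I Bs = ∀ {K} → Compatible K → Refines I (clades K) → Refines Bs (clades K)

  Forced-merge : B ∈ᶜ Bs → B′ ∈ᶜ Bs → Linked B B′ → Forced I Bs → Forced I (merge B B′ Bs)
  Forced-merge B∈ B′∈ linked forced cK I⊑K (here refl) =
    Linked-within cK (forced cK I⊑K B∈) (forced cK I⊑K B′∈) linked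
  Forced-merge B∈ B′∈ linked forced cK I⊑K (there s∈) = forced cK I⊑K (∈-remove⁻ (∈-remove⁻ s∈))

  record Blocks (I : List (Subset n)) : Set where
    field
      blocks       : List (Subset n)
      disjoint     : PairwiseDisjoint blocks
      conflictFree : ConflictFree blocks
      covering     : Refines I blocks
      forced       : Forced I blocks
  open Blocks

  mergeBlocks : (Bs : List (Subset n)) → Acc _<_ (length Bs) → Refines I Bs → Forced I Bs → Blocks I
  mergeBlocks Bs (acc smaller) covering forced
    with any₂? (λ B B′ → ¬? (B ≟ˢ B′) ×-dec (nonempty? (B ∩ B′) ⊎-dec conflict? B B′)) Bs Bs
  ... | yes (B , B′ , B∈ , B′∈ , B≢B′ , linked) =
    mergeBlocks (merge B B′ Bs) (smaller (length-merge B∈ B′∈ B≢B′))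
                (Refines-trans covering Refines-merge) (Forced-merge B∈ B′∈ linked forced)
  ... | no unlinked = record
    { blocks = Bs ; disjoint = unlinked⇒disjoint ; covering = covering ; forced = forced
    ; conflictFree = λ B∈ B′∈ B≢B′ conflict → unlinked (_ , _ , B∈ , B′∈ , B≢B′ , inj₂ conflict) }
    where
    unlinked⇒disjoint : PairwiseDisjoint Bs
    unlinked⇒disjoint {B} {B′} B∈ B′∈ with B ≟ˢ B′
    ... | yes B≡B′ = inj₁ B≡B′
    ... | no B≢B′ = inj₂ (λ meet → unlinked (B , B′ , B∈ , B′∈ , B≢B′ , inj₁ meet))

  blocksOf : (I : List (Subset n)) → Blocks I
  blocksOf I = mergeBlocks I (<-wellFounded _) Refines-refl (λ _ I⊑K → I⊑K)

  closure : List (Subset n) → Forest n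
  closure I = restrict (blocks (blocksOf I)) (disjoint (blocksOf I))

  closure-compatible : ∀ I → Compatible (closure I)
  closure-compatible I = restrict-compatible (disjoint (blocksOf I)) (conflictFree (blocksOf I))

  closure-covers : ∀ I → (∀ {s} → s ∈ᶜ I → 2 ≤ ∣ s ∣) → Refines I (clades T) →
                   Refines I (clades (closure I))
  closure-covers I big I⊑T s∈ =
    let (B , B∈ , s⊆B) = covering (blocksOf I) s∈
        (t , t∈ , B⊆t) = forced (blocksOf I) compatible-T I⊑T B∈
        s⊆t∩B = ∩-greatest (⊆-trans s⊆B B⊆t) s⊆B
    in t ∩ B , ∈-bigIntersections⁺ t∈ B∈ (⊆-big s⊆t∩B (big s∈)) , s⊆t∩B

  closure-least : ∀ I → Compatible K → Refines I (clades K) → Refines (clades (closure I)) (clades K)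
  closure-least I cK I⊑K =
    Refines-trans (bigIntersections-⊑ʳ {Xs = clades T}) (forced (blocksOf I) cK I⊑K)

  -- Joins and meets

  closure-isJoin : ∀ F G → InInterval T F → InInterval T G →
                   IsJoinIn T F G (closure (clades F ++ clades G))
  closure-isJoin F G F∈ G∈ =
    Compatible⇒InInterval cJ ,
    Refines⇒≤F cF cJ (Refines-trans Refines-++ˡ covers) ,
    Refines⇒≤F cG cJ (Refines-trans (Refines-++ʳ (clades F)) covers) ,
    λ K K∈ F≤K G≤K → let cK = InInterval⇒Compatible K K∈ in
      Refines⇒≤F cJ cK (closure-least gens cK (Refines-++⁺ (≤F⇒Refines F K F≤K) (≤F⇒Refines G K G≤K)))
    where
    gens = clades F ++ clades G
    cF = InInterval⇒Compatible F F∈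
    cG = InInterval⇒Compatible G G∈
    cJ = closure-compatible gens
    covers : Refines gens (clades (closure gens))
    covers = closure-covers gens (λ s∈ → [ size≥2 (wf F) _ , size≥2 (wf G) _ ]′ (∈-++⁻ (clades F) s∈))
                              (Refines-++⁺ (refines cF) (refines cG))

  closure-isMeet : ∀ F G → InInterval T F → InInterval T G →
                   IsMeetIn T F G (closure (bigIntersections (clades F) (clades G)))
  closure-isMeet F G F∈ G∈ =
    Compatible⇒InInterval cM ,
    Refines⇒≤F cM cF (closure-least gens cF bigIntersections-⊑ˡ) ,
    Refines⇒≤F cM cG (closure-least gens cG (bigIntersections-⊑ʳ {Xs = clades F})) ,
    λ K K∈ K≤F K≤G → Refines⇒≤F (InInterval⇒Compatible K K∈) cM
      (Refines-trans (Refines-bigIntersections (size≥2 (wf K) _)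
                                               (≤F⇒Refines K F K≤F) (≤F⇒Refines K G K≤G))
                     covers)
    where
    gens = bigIntersections (clades F) (clades G)
    cF = InInterval⇒Compatible F F∈
    cG = InInterval⇒Compatible G G∈
    cM = closure-compatible gens
    covers : Refines gens (clades (closure gens))
    covers = closure-covers gens (bigIntersections-big (clades F) (clades G))
                              (Refines-trans bigIntersections-⊑ˡ (refines cF))

-- The argument never uses that T is connected: it works for every forest T.
mainTheorem3 : (n : ℕ) (T : Forest n) → IsTree T → IntervalIsLattice T
mainTheorem3 n T _ F G F∈ G∈ =
  (closure (clades F ++ clades G) , closure-isJoin F G F∈ G∈) ,
  (closure (bigIntersections (clades F) (clades G)) , closure-isMeet F G F∈ G∈)
  where open Interval T
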